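{- Let $\Delta$ be a type environment of $\mathbf{F}_2^\mu$ and $T$ a type. (1) If $\Delta \vdash T : o$, then $T$ is of the form $\forall x{:}K.T'$ or $T_1 \Rightarrow T_2$. (2) If $\Delta \vdash T : *^n \Rightarrow *$ for some $n\ge 0$, then the $\to_o$-normal form of $T$ is second-order.
   Context: Types of $\mathbf{F}_2^\mu$: $T ::= F \mid x \mid \lambda x.T \mid \forall x{:}K.T \mid T\,T' \mid T \Rightarrow T'$ ($F$ type constants, $x$ type variables). Term kinds $K ::= * \mid * \Rightarrow K$; kinds $k ::= o \mid K$; $*^n\Rightarrow *$ abbreviates $*\Rightarrow\cdots\Rightarrow *\Rightarrow *$ with $n$ arrows. Type environments $\Delta ::= \cdot \mid x:K,\Delta \mid F:K,\Delta$. Kinding $\Delta \vdash T : k$: (i) $\Delta \vdash x : K$ (resp. $F:K$) if $x:K\in\Delta$ (resp. $F:K\in\Delta$); (ii) if $\Delta\vdash T_1 : *$ and $\Delta \vdash T_2 : *\Rightarrow K$ then $\Delta\vdash T_2\,T_1 : K$; (iii) if $\Delta, x:* \vdash T : K$ and $x \in \mathrm{FV}(T)$ then $\Delta \vdash \lambda x.T : * \Rightarrow K$; (iv) if $\Delta, x:K \vdash T : o$ or $\Delta, x:K\vdash T:*$ then $\Delta \vdash \forall x{:}K.T : o$; (v) if each of $T, T'$ has kind $o$ or $*$ then $\Delta \vdash T \Rightarrow T' : o$. $\to_o$ is the compatible closure of $(\lambda x.T)\,T' \to_o [T'/x]T$ (it is strongly normalizing and confluent on well-kinded types, so normal forms are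 unique). A type is flat if it is a variable $x$, a constant $F$, or an application $T_1\,T_2$ with $T_1,T_2$ flat. A type is second-order if it is flat, or of the form $\lambda x_1.\cdots\lambda x_n.T'$ with $T'$ flat and every $x_i \in \mathrm{FV}(T')$. -}

module Defs where

open import Data.Nat using (ℕ; zero; suc; _<_)
open import Data.List using (List; []; _∷_)
open import Data.List.Membership.Propositional using (_∈_)
open import Data.Product using (_×_; _,_; Σ; ∃; ∃-syntax)
open import Data.Sum using (_⊎_)
open import Data.Empty using (⊥)
open import Relation.Nullary using (¬_)
open import Relation.Binary.PropositionalEquality using (_≡_)
open import Relation.Binary.Construct.Closure.ReflexiveTransitive using (Star)

data TKind : Set where
  ⋆    : TKind
  ⋆⇒_  : TKind → TKind

data Kind : Set where
  o  : Kind
  tk : TKind → Kind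

stars : ℕ → TKind
stars zero    = ⋆
stars (suc n) = ⋆⇒ stars n

-- Types of F₂^μ, type variables as de Bruijn indices, constants named by ℕ.
-- lam and all bind variable 0 in their body.
data Ty : Set where
  var   : ℕ → Ty
  con   : ℕ → Ty
  lam   : Ty → Ty
  all   : TKind → Ty → Ty
  app   : Ty → Ty → Ty
  arr   : Ty → Ty → Ty

data _∈FV_ : ℕ → Ty → Set where
  fv-var  : ∀ {x} → x ∈FV var x
  fv-lam  : ∀ {x T} → suc x ∈FV T → x ∈FV lam T
  fv-all  : ∀ {x K T} → suc x ∈FV T → x ∈FV all K T
  fv-appˡ : ∀ {x T T'} → x ∈FV T → x ∈FV app T T'
  fv-appʳ : ∀ {x T T'} → x ∈FV T' → x ∈FV app T T'
  fv-arrˡ : ∀ {x T T'} → x ∈FV T → x ∈FV arr T T'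
  fv-arrʳ : ∀ {x T T'} → x ∈FV T' → x ∈FV arr T T'

ext : (ℕ → ℕ) → ℕ → ℕ
ext ρ zero    = zero
ext ρ (suc x) = suc (ρ x)

rename : (ℕ → ℕ) → Ty → Ty
rename ρ (var x)   = var (ρ x)
rename ρ (con F)   = con F
rename ρ (lam T)   = lam (rename (ext ρ) T)
rename ρ (all K T) = all K (rename (ext ρ) T)
rename ρ (app T U) = app (rename ρ T) (rename ρ U)
rename ρ (arr T U) = arr (rename ρ T) (rename ρ U)

exts : (ℕ → Ty) → ℕ → Ty
exts σ zero    = var zero
exts σ (suc x) = rename suc (σ x)

subst : (ℕ → Ty) → Ty → Ty
subst σ (var x)   = σ x
subst σ (con F)   = con F
subst σ (lam T)   = lam (subst (exts σ) T)
subst σ (all K T) = all K (subst (exts σ) T)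
subst σ (app T U) = app (subst σ T) (subst σ U)
subst σ (arr T U) = arr (subst σ T) (subst σ U)

subst0 : Ty → ℕ → Ty
subst0 U zero    = U
subst0 U (suc x) = var x

_[_] : Ty → Ty → Ty
T [ U ] = subst (subst0 U) T

data _→o_ : Ty → Ty → Set where
  β     : ∀ {T U} → app (lam T) U →o (T [ U ])
  ξ-lam : ∀ {T T'} → T →o T' → lam T →o lam T'
  ξ-all : ∀ {K T T'} → T →o T' → all K T →o all K T'
  ξ-appˡ : ∀ {T T' U} → T →o T' → app T U →o app T' U
  ξ-appʳ : ∀ {T U U'} → U →o U' → app T U →o app T U'
  ξ-arrˡ : ∀ {T T' U} → T →o T' → arr T U →o arr T' U
  ξ-arrʳ : ∀ {T U U'} → U →o U' → arr T U →o arr T U'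

_→o*_ : Ty → Ty → Set
_→o*_ = Star _→o_

Normal : Ty → Set
Normal T = ∀ T' → ¬ (T →o T')

-- Type environments: kinds of type constants (name ↦ term kind) and
-- a de Bruijn context of term kinds for type variables (head = variable 0).
record Env : Set where
  constructor env
  field
    consts : List (ℕ × TKind)
    vars   : List TKind
open Env public

data _∋_∶_ : List TKind → ℕ → TKind → Set where
  here  : ∀ {K Γ} → (K ∷ Γ) ∋ zero ∶ K
  there : ∀ {K K' Γ x} → Γ ∋ x ∶ K → (K' ∷ Γ) ∋ suc x ∶ K

_,,_ : Env → TKind → Env
env C V ,, K = env C (K ∷ V)

data OorStar : Kind → Set where
  is-o    : OorStar o
  is-star : OorStar (tk ⋆)

data _⊢_∶_ : Env → Ty → Kind → Set where
  k-var : ∀ {Δ x K} → vars Δ ∋ x ∶ K → Δ ⊢ var x ∶ tk K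
  k-con : ∀ {Δ F K} → (F , K) ∈ consts Δ → Δ ⊢ con F ∶ tk K
  k-app : ∀ {Δ T₁ T₂ K} → Δ ⊢ T₁ ∶ tk ⋆ → Δ ⊢ T₂ ∶ tk (⋆⇒ K) → Δ ⊢ app T₂ T₁ ∶ tk K
  k-lam : ∀ {Δ T K} → (Δ ,, ⋆) ⊢ T ∶ tk K → zero ∈FV T → Δ ⊢ lam T ∶ tk (⋆⇒ K)
  k-all : ∀ {Δ K T k} → OorStar k → (Δ ,, K) ⊢ T ∶ k → Δ ⊢ all K T ∶ o
  k-arr : ∀ {Δ T T' k k'} → OorStar k → OorStar k' → Δ ⊢ T ∶ k → Δ ⊢ T' ∶ k' → Δ ⊢ arr T T' ∶ o

data Flat : Ty → Set where
  f-var : ∀ {x} → Flat (var x)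
  f-con : ∀ {F} → Flat (con F)
  f-app : ∀ {T₁ T₂} → Flat T₁ → Flat T₂ → Flat (app T₁ T₂)

lams : ℕ → Ty → Ty
lams zero    T = T
lams (suc n) T = lam (lams n T)

-- second-order: λx₁…λxₙ.T' with T' flat and every xᵢ free in T'
-- (n = 0 is the flat case; the bound xᵢ are the indices 0 … n-1 in T')
SecondOrder : Ty → Set
SecondOrder T = ∃[ n ] ∃[ T' ] (T ≡ lams n T' × Flat T' × (∀ i → i < n → i ∈FV T'))

module Submission where

-- Proof idea.
--  (1) The only kinding rules concluding kind o are those for ∀ and ⇒, so a
--      type of kind o is syntactically a ∀-type or an arrow.
--  (2) Kinding is preserved by →o (subject reduction), so the normal form N
--      of a type of kind *ⁿ ⇒ * again has that kind.  A normal, well-kinded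
--      type that is not a λ is flat: its applications cannot be β-redexes,
--      and the arguments, having kind *, are never λs.  Peeling off the
--      leading λs of N (at most one per arrow of its kind) leaves a flat body, and each
--      peeled λ binds a variable occurring in the body by the side condition
--      of the λ-kinding rule.
-- Subject reduction needs the usual substitution lemma, and also that →o
-- never erases a free variable (to keep the side condition of the λ rule);
-- the latter holds because the abstraction of every β-redex in a well-kinded
-- type uses its bound variable.

open import Defs
open import Data.Nat using (ℕ; zero; suc; _+_; _<_)
open import Data.Nat.Properties using (+-suc; +-identityʳ; m<1+n⇒m<n∨m≡n)
open import Data.List using (List; _∷_)
open import Data.List.Membership.Propositional using (_∈_)
open import Data.Product using (_×_; _,_; ∃-syntax)
open import Data.Sum using (_⊎_; inj₁; inj₂)
open import Data.Empty using (⊥-elim)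
open import Relation.Binary.PropositionalEquality using (_≡_; refl; sym)
  renaming (subst to transport)
open import Relation.Binary.Construct.Closure.ReflexiveTransitive using (ε; _◅_)

rename-fv : ∀ {x T} (ρ : ℕ → ℕ) → x ∈FV T → ρ x ∈FV rename ρ T
rename-fv ρ fv-var      = fv-var
rename-fv ρ (fv-lam p)  = fv-lam  (rename-fv (ext ρ) p)
rename-fv ρ (fv-all p)  = fv-all  (rename-fv (ext ρ) p)
rename-fv ρ (fv-appˡ p) = fv-appˡ (rename-fv ρ p)
rename-fv ρ (fv-appʳ p) = fv-appʳ (rename-fv ρ p)
rename-fv ρ (fv-arrˡ p) = fv-arrˡ (rename-fv ρ p)
rename-fv ρ (fv-arrʳ p) = fv-arrʳ (rename-fv ρ p)

subst-fv : ∀ {x y T} (σ : ℕ → Ty) → y ∈FV T → x ∈FV σ y → x ∈FV subst σ T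
subst-fv σ fv-var      q = q
subst-fv σ (fv-lam p)  q = fv-lam  (subst-fv (exts σ) p (rename-fv suc q))
subst-fv σ (fv-all p)  q = fv-all  (subst-fv (exts σ) p (rename-fv suc q))
subst-fv σ (fv-appˡ p) q = fv-appˡ (subst-fv σ p q)
subst-fv σ (fv-appʳ p) q = fv-appʳ (subst-fv σ p q)
subst-fv σ (fv-arrˡ p) q = fv-arrˡ (subst-fv σ p q)
subst-fv σ (fv-arrʳ p) q = fv-arrʳ (subst-fv σ p q)

_∶_⇒ʳ_ : (ℕ → ℕ) → List TKind → List TKind → Set
ρ ∶ Γ ⇒ʳ Γ' = ∀ {x K} → Γ ∋ x ∶ K → Γ' ∋ ρ x ∶ K

_∶_⇒ˢ_ : (ℕ → Ty) → Env → Env → Set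
σ ∶ Δ ⇒ˢ Δ' = ∀ {x K} → vars Δ ∋ x ∶ K → Δ' ⊢ σ x ∶ tk K

_⊆ᶜ_ : Env → Env → Set
Δ ⊆ᶜ Δ' = ∀ {F K} → (F , K) ∈ consts Δ → (F , K) ∈ consts Δ'

ext-ren : ∀ {ρ Γ Γ' K} → ρ ∶ Γ ⇒ʳ Γ' → ext ρ ∶ (K ∷ Γ) ⇒ʳ (K ∷ Γ')
ext-ren hρ here      = here
ext-ren hρ (there p) = there (hρ p)

rename-⊢ : ∀ {Δ Δ' T k} (ρ : ℕ → ℕ) → ρ ∶ vars Δ ⇒ʳ vars Δ' → Δ ⊆ᶜ Δ' →
  Δ ⊢ T ∶ k → Δ' ⊢ rename ρ T ∶ k
rename-⊢ ρ hρ hc (k-var p)        = k-var (hρ p)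
rename-⊢ ρ hρ hc (k-con p)        = k-con (hc p)
rename-⊢ ρ hρ hc (k-app d e)      = k-app (rename-⊢ ρ hρ hc d) (rename-⊢ ρ hρ hc e)
rename-⊢ ρ hρ hc (k-lam d f)      =
  k-lam (rename-⊢ (ext ρ) (ext-ren hρ) hc d) (rename-fv (ext ρ) f)
rename-⊢ ρ hρ hc (k-all s d)      = k-all s (rename-⊢ (ext ρ) (ext-ren hρ) hc d)
rename-⊢ ρ hρ hc (k-arr s s' d e) = k-arr s s' (rename-⊢ ρ hρ hc d) (rename-⊢ ρ hρ hc e)

weaken-⊢ : ∀ {Δ T k K} → Δ ⊢ T ∶ k → (Δ ,, K) ⊢ rename suc T ∶ k
weaken-⊢ = rename-⊢ suc there (λ p → p)

exts-subst : ∀ {σ Δ Δ' K} → σ ∶ Δ ⇒ˢ Δ' → exts σ ∶ (Δ ,, K) ⇒ˢ (Δ' ,, K)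
exts-subst hσ here      = k-var here
exts-subst hσ (there p) = weaken-⊢ (hσ p)

subst-⊢ : ∀ {Δ Δ' T k} (σ : ℕ → Ty) → σ ∶ Δ ⇒ˢ Δ' → Δ ⊆ᶜ Δ' →
  Δ ⊢ T ∶ k → Δ' ⊢ subst σ T ∶ k
subst-⊢ σ hσ hc (k-var p)        = hσ p
subst-⊢ σ hσ hc (k-con p)        = k-con (hc p)
subst-⊢ σ hσ hc (k-app d e)      = k-app (subst-⊢ σ hσ hc d) (subst-⊢ σ hσ hc e)
subst-⊢ {Δ} {Δ'} σ hσ hc (k-lam d f) =
  k-lam (subst-⊢ (exts σ) (exts-subst {Δ = Δ} {Δ'} hσ) hc d) (subst-fv (exts σ) f fv-var)
subst-⊢ {Δ} {Δ'} σ hσ hc (k-all s d) =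
  k-all s (subst-⊢ (exts σ) (exts-subst {Δ = Δ} {Δ'} hσ) hc d)
subst-⊢ σ hσ hc (k-arr s s' d e) = k-arr s s' (subst-⊢ σ hσ hc d) (subst-⊢ σ hσ hc e)

β-⊢ : ∀ {Δ B U k} → (Δ ,, ⋆) ⊢ B ∶ k → Δ ⊢ U ∶ tk ⋆ → Δ ⊢ B [ U ] ∶ k
β-⊢ {Δ} {B} {U} d u = subst-⊢ (subst0 U) subst0-⊢ (λ p → p) d
  where
  subst0-⊢ : subst0 U ∶ (Δ ,, ⋆) ⇒ˢ Δ
  subst0-⊢ here      = u
  subst0-⊢ (there p) = k-var p

-- →o erases no free variable of a well-kinded type: in a redex (λ.B) U the
-- bound variable occurs in B, so the free variables of U survive in B [ U ].
→o-keeps-fv : ∀ {Δ T T' k x} → Δ ⊢ T ∶ k → T →o T' → x ∈FV T → x ∈FV T'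
→o-keeps-fv (k-app u (k-lam d f)) β (fv-appˡ (fv-lam p)) = subst-fv _ p fv-var
→o-keeps-fv (k-app u (k-lam d f)) β (fv-appʳ p)          = subst-fv _ f p
→o-keeps-fv (k-lam d f)       (ξ-lam r)  (fv-lam p)  = fv-lam (→o-keeps-fv d r p)
→o-keeps-fv (k-all s d)       (ξ-all r)  (fv-all p)  = fv-all (→o-keeps-fv d r p)
→o-keeps-fv (k-app u d)       (ξ-appˡ r) (fv-appˡ p) = fv-appˡ (→o-keeps-fv d r p)
→o-keeps-fv (k-app u d)       (ξ-appˡ r) (fv-appʳ p) = fv-appʳ p
→o-keeps-fv (k-app u d)       (ξ-appʳ r) (fv-appˡ p) = fv-appˡ p
→o-keeps-fv (k-app u d)       (ξ-appʳ r) (fv-appʳ p) = fv-appʳ (→o-keeps-fv u r p)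
→o-keeps-fv (k-arr s s' d e)  (ξ-arrˡ r) (fv-arrˡ p) = fv-arrˡ (→o-keeps-fv d r p)
→o-keeps-fv (k-arr s s' d e)  (ξ-arrˡ r) (fv-arrʳ p) = fv-arrʳ p
→o-keeps-fv (k-arr s s' d e)  (ξ-arrʳ r) (fv-arrˡ p) = fv-arrˡ p
→o-keeps-fv (k-arr s s' d e)  (ξ-arrʳ r) (fv-arrʳ p) = fv-arrʳ (→o-keeps-fv e r p)

subject-reduction : ∀ {Δ T T' k} → Δ ⊢ T ∶ k → T →o T' → Δ ⊢ T' ∶ k
subject-reduction (k-app u (k-lam d f)) β = β-⊢ d u
subject-reduction (k-lam d f)      (ξ-lam r)  = k-lam (subject-reduction d r) (→o-keeps-fv d r f)
subject-reduction (k-all s d)      (ξ-all r)  = k-all s (subject-reduction d r)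
subject-reduction (k-app u d)      (ξ-appˡ r) = k-app u (subject-reduction d r)
subject-reduction (k-app u d)      (ξ-appʳ r) = k-app (subject-reduction u r) d
subject-reduction (k-arr s s' d e) (ξ-arrˡ r) = k-arr s s' (subject-reduction d r) e
subject-reduction (k-arr s s' d e) (ξ-arrʳ r) = k-arr s s' d (subject-reduction e r)

subject-reduction* : ∀ {Δ T T' k} → Δ ⊢ T ∶ k → T →o* T' → Δ ⊢ T' ∶ k
subject-reduction* d ε        = d
subject-reduction* d (r ◅ rs) = subject-reduction* (subject-reduction d r) rs

normal-lam : ∀ {B} → Normal (lam B) → Normal B
normal-lam nm _ r = nm _ (ξ-lam r)

normal-appˡ : ∀ {A B} → Normal (app A B) → Normal A
normal-appˡ nm _ r = nm _ (ξ-appˡ r)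

normal-appʳ : ∀ {A B} → Normal (app A B) → Normal B
normal-appʳ nm _ r = nm _ (ξ-appʳ r)

data NotLam : Ty → Set where
  nl-var : ∀ {x} → NotLam (var x)
  nl-con : ∀ {F} → NotLam (con F)
  nl-app : ∀ {A B} → NotLam (app A B)

star-notLam : ∀ {Δ T} → Δ ⊢ T ∶ tk ⋆ → NotLam T
star-notLam (k-var _)   = nl-var
star-notLam (k-con _)   = nl-con
star-notLam (k-app _ _) = nl-app

normal-head-notLam : ∀ {Δ A B K} → Normal (app A B) → Δ ⊢ A ∶ tk K → NotLam A
normal-head-notLam nm (k-var _)   = nl-var
normal-head-notLam nm (k-con _)   = nl-con
normal-head-notLam nm (k-app _ _) = nl-app
normal-head-notLam nm (k-lam _ _) = ⊥-elim (nm _ β)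

normal-flat : ∀ {Δ T K} → Δ ⊢ T ∶ tk K → Normal T → NotLam T → Flat T
normal-flat (k-var _)   nm nl = f-var
normal-flat (k-con _)   nm nl = f-con
normal-flat (k-app u d) nm nl =
  f-app (normal-flat d (normal-appˡ nm) (normal-head-notLam nm d))
        (normal-flat u (normal-appʳ nm) (star-notLam u))

lams-fv : ∀ {x} m T → x ∈FV lams m T → (x + m) ∈FV T
lams-fv {x} zero    T p          = transport (_∈FV T) (sym (+-identityʳ x)) p
lams-fv {x} (suc m) T (fv-lam p) = transport (_∈FV T) (sym (+-suc x m)) (lams-fv m T p)

lam-secondOrder : ∀ {B} → SecondOrder B → zero ∈FV B → SecondOrder (lam B)
lam-secondOrder (m , T' , refl , fl , bound) f = suc m , T' , refl , fl , bound'
  where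
  -- the new binder is variable m of T'; the others are those of B
  bound' : ∀ i → i < suc m → i ∈FV T'
  bound' i i<1+m with m<1+n⇒m<n∨m≡n i<1+m
  ... | inj₁ i<m  = bound i i<m
  ... | inj₂ refl = lams-fv m T' f

normal-secondOrder : ∀ {Δ} n T → Δ ⊢ T ∶ tk (stars n) → Normal T → SecondOrder T
normal-secondOrder (suc n) (lam B) (k-lam d f) nm =
  lam-secondOrder (normal-secondOrder n B d (normal-lam nm)) f
normal-secondOrder n T@(var _)   d nm = 0 , T , refl , normal-flat d nm nl-var , λ _ ()
normal-secondOrder n T@(con _)   d nm = 0 , T , refl , normal-flat d nm nl-con , λ _ ()
normal-secondOrder n T@(app _ _) d nm = 0 , T , refl , normal-flat d nm nl-app , λ _ ()

kind-o-shape : ∀ {Δ T} → Δ ⊢ T ∶ o →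
  (∃[ K ] ∃[ T' ] T ≡ all K T') ⊎ (∃[ T₁ ] ∃[ T₂ ] T ≡ arr T₁ T₂)
kind-o-shape (k-all {K = K} {T = T'} _ _)       = inj₁ (K , T' , refl)
kind-o-shape (k-arr {T = T₁} {T' = T₂} _ _ _ _) = inj₂ (T₁ , T₂ , refl)

theorem9 : (Δ : Env) (T : Ty) →
    (Δ ⊢ T ∶ o → (∃[ K ] ∃[ T' ] T ≡ all K T') ⊎ (∃[ T₁ ] ∃[ T₂ ] T ≡ arr T₁ T₂))
    × (∀ n → Δ ⊢ T ∶ tk (stars n) → ∀ N → T →o* N → Normal N → SecondOrder N)
theorem9 Δ T = kind-o-shape , normalForm-secondOrder
  where
  normalForm-secondOrder : ∀ n → Δ ⊢ T ∶ tk (stars n) →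
    ∀ N → T →o* N → Normal N → SecondOrder N
  normalForm-secondOrder n d N T↠N nm = normal-secondOrder n N (subject-reduction* d T↠N) nm
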